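{- Let $G$ be a finite abelian $p$-group with $p^dG=0$, $R=\mathbb{Z}/p^d\mathbb{Z}$, $\cdot$ the pairing below. For $\mathbf{g}=(g,h),\mathbf{g}'=(g',h')\in G^2$ let $B(\mathbf{g},\mathbf{g}')=-(g-g')\cdot(h-h')$, $U_2(\mathbf{g})=g\cdot h$, $B_2(\mathbf{g},\mathbf{g}')=g\cdot h'+g'\cdot h$. Let $\mathrm{Iso}^{U_2,B_2}_G$ be the set of subgroups $W\le G^2$ with $U_2(\mathbf{w})=0$ and $B_2(\mathbf{w},\mathbf{w}')=0$ for all $\mathbf{w},\mathbf{w}'\in W$. Then for $\mathbf{g}_1,\dots,\mathbf{g}_n\in G^2$, we have $B(\mathbf{g}_k,\mathbf{g}_l)=0$ for all $k,l\in[n]$ if and only if there exists $W\in\mathrm{Iso}^{U_2,B_2}_G$ with $\langle\mathbf{g}_1-\mathbf{g}_n,\dots,\mathbf{g}_{n-1}-\mathbf{g}_n\rangle=W$.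
   Context: Write $G=\mathbb{Z}/p^{d_1}\mathbb{Z}\times\cdots\times\mathbb{Z}/p^{d_r}\mathbb{Z}$ with $d\ge d_1\ge\cdots\ge d_r\ge1$ and $(x_i)\cdot(y_i)=\sum_i p^{d-d_i}x_iy_i\bmod p^d\in R$. (The condition on the left is membership of $(\mathbf{g}_1,\dots,\mathbf{g}_n)$ in the "trivial part" $G_{tr}$ for $U=0$ and this $B$.) -}

module Defs where

open import Level using (Level; 0ℓ)
open import Data.Nat as ℕ using (ℕ; zero; suc; _^_)
open import Data.Fin using (Fin; zero; suc)
open import Data.Integer using (ℤ; +_; _+_; _-_; _*_; -_)
open import Data.Integer.Divisibility using (_∣_)
open import Data.Product using (_×_; _,_; proj₁; proj₂; Σ)
open import Function.Bundles using (_⇔_)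

sumFin : ∀ {k} → (Fin k → ℤ) → ℤ
sumFin {zero}  f = + 0
sumFin {suc k} f = f zero + sumFin (λ i → f (suc i))

-- The group G = Z/p^{ds 0} × ... × Z/p^{ds (r-1)}, with pairing into R = Z/p^d.
-- Elements of R are integers; "= 0 in R" means divisible by p^d.
module G (p d r : ℕ) (ds : Fin r → ℕ) where

  Elem : Set
  Elem = Fin r → ℤ

  _≈_ : Elem → Elem → Set
  x ≈ y = ∀ i → (+ (p ^ ds i)) ∣ (x i - y i)

  0G : Elem
  0G _ = + 0

  _⊕_ : Elem → Elem → Elem
  (x ⊕ y) i = x i + y i

  ⊝_ : Elem → Elem
  (⊝ x) i = - x i

  _⊖_ : Elem → Elem → Elem
  x ⊖ y = x ⊕ (⊝ y)

  _⊛_ : ℤ → Elem → Elem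
  (c ⊛ x) i = c * x i

  _·_ : Elem → Elem → ℤ
  x · y = sumFin (λ i → (+ (p ^ (d ℕ.∸ ds i))) * (x i * y i))

  IsZeroR : ℤ → Set
  IsZeroR z = (+ (p ^ d)) ∣ z

  Pair : Set
  Pair = Elem × Elem

  _≈²_ : Pair → Pair → Set
  (g , h) ≈² (g' , h') = (g ≈ g') × (h ≈ h')

  0² : Pair
  0² = 0G , 0G

  _⊕²_ : Pair → Pair → Pair
  (g , h) ⊕² (g' , h') = (g ⊕ g') , (h ⊕ h')

  ⊝²_ : Pair → Pair
  ⊝² (g , h) = (⊝ g) , (⊝ h)

  _⊖²_ : Pair → Pair → Pair
  a ⊖² b = a ⊕² (⊝² b)

  _⊛²_ : ℤ → Pair → Pair
  c ⊛² (g , h) = (c ⊛ g) , (c ⊛ h)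

  B : Pair → Pair → ℤ
  B (g , h) (g' , h') = - ((g ⊖ g') · (h ⊖ h'))

  U₂ : Pair → ℤ
  U₂ (g , h) = g · h

  B₂ : Pair → Pair → ℤ
  B₂ (g , h) (g' , h') = (g · h') + (g' · h)

  record IsSubgroup (W : Pair → Set) : Set where
    field
      resp  : ∀ {a b} → a ≈² b → W a → W b
      zero∈ : W 0²
      add∈  : ∀ {a b} → W a → W b → W (a ⊕² b)
      neg∈  : ∀ {a} → W a → W (⊝² a)

  record InIso (W : Pair → Set) : Set where
    field
      subgroup : IsSubgroup W
      U₂-zero  : ∀ w → W w → IsZeroR (U₂ w)
      B₂-zero  : ∀ w w' → W w → W w' → IsZeroR (B₂ w w')

  lin : ∀ {m} → (Fin m → ℤ) → (Fin m → Pair) → Pair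
  lin {zero}  c v = 0²
  lin {suc m} c v = (c zero ⊛² v zero) ⊕² lin (λ k → c (suc k)) (λ k → v (suc k))

  Span : ∀ {m} → (Fin m → Pair) → Pair → Set
  Span {m} v x = Σ (Fin m → ℤ) (λ c → x ≈² lin c v)

{-# OPTIONS --safe #-}
module Submission where

-- U₂ is a quadratic form on G² with polar form B₂, and B(𝐠, 𝐠') = − U₂(𝐠 − 𝐠').
-- So if B vanishes on the 𝐠ₖ, the differences 𝐯ₖ = 𝐠ₖ − 𝐠ₙ satisfy U₂(𝐯ₖ) = − B(𝐠ₖ, 𝐠ₙ) = 0
-- and B₂(𝐯ₖ, 𝐯ₗ) = U₂(𝐯ₖ) + U₂(𝐯ₗ) − U₂(𝐠ₖ − 𝐠ₗ) = 0, and by bilinearity their span is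
-- totally isotropic. Conversely, an isotropic subgroup containing every 𝐠ₖ − 𝐠ₙ contains
-- 𝐠ₖ − 𝐠ₗ, on which U₂ = − B has to vanish. All computations are on integer
-- representatives; U₂ and B₂ are well defined modulo p^d because p^(d − dᵢ) · p^dᵢ = p^d,
-- which is the only place a hypothesis on p and the dᵢ (namely dᵢ ≤ d) is used.

open import Defs
open import Data.Fin as F using (Fin; zero; suc; inject₁; fromℕ)
open import Data.Fin.Relation.Unary.Top using (view; ‵fromℕ; ‵inject₁)
open import Data.Integer using (ℤ; +_; _+_; _-_; _*_; -_; -1ℤ)
open import Data.Integer.Divisibility.Signed
  using ( _∣_; divides; ∣ᵤ⇒∣; ∣⇒∣ᵤ; ∣m∣n⇒∣m+n; ∣m∣n⇒∣m-n; ∣m⇒∣-m; ∣n⇒∣m*n; ∣m⇒∣m*n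
        ; ∣m+n∣n⇒∣m; *-monoʳ-∣)
import Data.Integer.Properties as ℤ
open import Algebra.Properties.Semiring.Sum ℤ.+-*-semiring
  using (sum; sum-cong-≗; ∑-distrib-+; *-distribˡ-sum)
open import Data.Integer.Tactic.RingSolver using (solve-∀)
open import Data.Nat using (ℕ; zero; suc; _≤_; _^_; _∸_)
open import Data.Nat.Primality using (Prime)
import Data.Nat.Properties as ℕ
open import Data.Product using (Σ; _×_; _,_; proj₁; proj₂)
open import Function.Base using (_∘_)
open import Function.Bundles using (_⇔_; mk⇔; Equivalence)
import Function.Properties.Equivalence as ⇔
open import Relation.Binary.PropositionalEquality
  using (_≡_; _≗_; refl; sym; trans; cong; cong₂; subst; module ≡-Reasoning)

open ≡-Reasoning

sumFin≡sum : ∀ {k} (f : Fin k → ℤ) → sumFin f ≡ sum f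
sumFin≡sum {zero}  f = refl
sumFin≡sum {suc k} f = cong (_+_ (f zero)) (sumFin≡sum (f ∘ suc))

sumFin-cong : ∀ {k} {f g : Fin k → ℤ} → f ≗ g → sumFin f ≡ sumFin g
sumFin-cong {f = f} {g} f≗g = begin
  sumFin f  ≡⟨ sumFin≡sum f ⟩
  sum f     ≡⟨ sum-cong-≗ f≗g ⟩
  sum g     ≡⟨ sumFin≡sum g ⟨
  sumFin g  ∎

sumFin-split : ∀ {k} {f g h : Fin k → ℤ} → (∀ i → f i ≡ g i + h i) → sumFin f ≡ sumFin g + sumFin h
sumFin-split {f = f} {g} {h} f≗g+h = begin
  sumFin f                 ≡⟨ sumFin≡sum f ⟩
  sum f                    ≡⟨ sum-cong-≗ f≗g+h ⟩
  sum (λ i → g i + h i)    ≡⟨ ∑-distrib-+ g h ⟩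
  sum g + sum h            ≡⟨ cong₂ _+_ (sumFin≡sum g) (sumFin≡sum h) ⟨
  sumFin g + sumFin h      ∎

sumFin-scale : ∀ {k} c {f g : Fin k → ℤ} → (∀ i → f i ≡ c * g i) → sumFin f ≡ c * sumFin g
sumFin-scale c {f} {g} f≗c*g = begin
  sumFin f                 ≡⟨ sumFin≡sum f ⟩
  sum f                    ≡⟨ sum-cong-≗ f≗c*g ⟩
  sum (λ i → c * g i)      ≡⟨ *-distribˡ-sum c g ⟨
  c * sum g                ≡⟨ cong (c *_) (sumFin≡sum g) ⟨
  c * sumFin g             ∎

∣+0 : ∀ {k} → k ∣ + 0
∣+0 = divides (+ 0) refl

∣-sumFin : ∀ {n k} (f : Fin k → ℤ) → (∀ i → n ∣ f i) → n ∣ sumFin f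
∣-sumFin {k = zero}  f n∣f = ∣+0
∣-sumFin {k = suc k} f n∣f = ∣m∣n⇒∣m+n (n∣f zero) (∣-sumFin (f ∘ suc) (n∣f ∘ suc))

∣m-n∣n⇒∣m : ∀ {i m n} → i ∣ m - n → i ∣ n → i ∣ m
∣m-n∣n⇒∣m i∣m-n i∣n = ∣m+n∣n⇒∣m i∣m-n (∣m⇒∣-m i∣n)

module Properties (p d r : ℕ) (ds : Fin r → ℕ) where
  open G p d r ds

  weight : Fin r → ℤ
  weight i = + (p ^ (d ∸ ds i))

  pᵈ : ℤ
  pᵈ = + (p ^ d)

  ·-cong : ∀ {x x' y y'} → x ≗ x' → y ≗ y' → x · y ≡ x' · y'
  ·-cong x≗x' y≗y' = sumFin-cong (λ i → cong₂ (λ a b → weight i * (a * b)) (x≗x' i) (y≗y' i))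

  ·-comm : ∀ x y → x · y ≡ y · x
  ·-comm x y = sumFin-cong (λ i → cong (weight i *_) (ℤ.*-comm (x i) (y i)))

  ·-distribʳ-⊕ : ∀ x y z → (x ⊕ y) · z ≡ x · z + y · z
  ·-distribʳ-⊕ x y z = sumFin-split (λ i → distrib (weight i) (x i) (y i) (z i))
    where
      distrib : ∀ w a b c → w * ((a + b) * c) ≡ w * (a * c) + w * (b * c)
      distrib = solve-∀

  ·-distribˡ-⊕ : ∀ x y z → x · (y ⊕ z) ≡ x · y + x · z
  ·-distribˡ-⊕ x y z = sumFin-split (λ i → distrib (weight i) (x i) (y i) (z i))
    where
      distrib : ∀ w a b c → w * (a * (b + c)) ≡ w * (a * b) + w * (a * c)
      distrib = solve-∀

  ·-⊛ˡ : ∀ c x y → (c ⊛ x) · y ≡ c * (x · y)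
  ·-⊛ˡ c x y = sumFin-scale c (λ i → pull c (weight i) (x i) (y i))
    where
      pull : ∀ c w a b → w * ((c * a) * b) ≡ c * (w * (a * b))
      pull = solve-∀

  ·-⊛ʳ : ∀ c x y → x · (c ⊛ y) ≡ c * (x · y)
  ·-⊛ʳ c x y = sumFin-scale c (λ i → pull c (weight i) (x i) (y i))
    where
      pull : ∀ c w a b → w * (a * (c * b)) ≡ c * (w * (a * b))
      pull = solve-∀

  ·-⊝ˡ : ∀ x y → (⊝ x) · y ≡ - (x · y)
  ·-⊝ˡ x y = trans (sumFin-scale -1ℤ (λ i → pull (weight i) (x i) (y i))) (ℤ.-1*i≡-i (x · y))
    where
      pull : ∀ w a b → w * (- a * b) ≡ -1ℤ * (w * (a * b))
      pull = solve-∀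

  ·-⊝ʳ : ∀ x y → x · (⊝ y) ≡ - (x · y)
  ·-⊝ʳ x y = trans (sumFin-scale -1ℤ (λ i → pull (weight i) (x i) (y i))) (ℤ.-1*i≡-i (x · y))
    where
      pull : ∀ w a b → w * (a * - b) ≡ -1ℤ * (w * (a * b))
      pull = solve-∀

  -- (+ 0 ⊛ x) reduces to 0G, and + 0 * z to + 0.
  ·-zeroˡ : ∀ y → 0G · y ≡ + 0
  ·-zeroˡ y = ·-⊛ˡ (+ 0) y y

  ·-zeroʳ : ∀ x → x · 0G ≡ + 0
  ·-zeroʳ x = ·-⊛ʳ (+ 0) x x

  ·-⊖ˡ : ∀ x y z → (x ⊖ y) · z ≡ x · z - y · z
  ·-⊖ˡ x y z = trans (·-distribʳ-⊕ x (⊝ y) z) (cong (_+_ (x · z)) (·-⊝ˡ y z))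

  ·-⊖ʳ : ∀ x y z → x · (y ⊖ z) ≡ x · y - x · z
  ·-⊖ʳ x y z = trans (·-distribˡ-⊕ x y (⊝ z)) (cong (_+_ (x · y)) (·-⊝ʳ x z))

  U₂-⊕ : ∀ x y → U₂ (x ⊕² y) ≡ U₂ x + U₂ y + B₂ x y
  U₂-⊕ (g , h) (g' , h') = begin
    (g ⊕ g') · (h ⊕ h')                    ≡⟨ ·-distribʳ-⊕ g g' (h ⊕ h') ⟩
    g · (h ⊕ h') + g' · (h ⊕ h')           ≡⟨ cong₂ _+_ (·-distribˡ-⊕ g h h') (·-distribˡ-⊕ g' h h') ⟩
    (g · h + g · h') + (g' · h + g' · h')  ≡⟨ regroup (g · h) (g · h') (g' · h) (g' · h') ⟩
    g · h + g' · h' + (g · h' + g' · h)    ∎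
    where
      regroup : ∀ a b c e → (a + b) + (c + e) ≡ a + e + (b + c)
      regroup = solve-∀

  U₂-⊛ : ∀ c x → U₂ (c ⊛² x) ≡ c * (c * U₂ x)
  U₂-⊛ c (g , h) = trans (·-⊛ˡ c g (c ⊛ h)) (cong (c *_) (·-⊛ʳ c g h))

  U₂-⊝ : ∀ x → U₂ (⊝² x) ≡ U₂ x
  U₂-⊝ (g , h) = trans (·-⊝ˡ g (⊝ h)) (trans (cong -_ (·-⊝ʳ g h)) (ℤ.neg-involutive (g · h)))

  U₂-0² : U₂ 0² ≡ + 0
  U₂-0² = ·-zeroˡ 0G

  B₂-comm : ∀ x y → B₂ x y ≡ B₂ y x
  B₂-comm (g , h) (g' , h') = ℤ.+-comm (g · h') (g' · h)

  B₂-⊕ʳ : ∀ x y z → B₂ x (y ⊕² z) ≡ B₂ x y + B₂ x z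
  B₂-⊕ʳ (g , h) (k , l) (k' , l') =
    trans (cong₂ _+_ (·-distribˡ-⊕ g l l') (·-distribʳ-⊕ k k' h))
          (interchange (g · l) (g · l') (k · h) (k' · h))
    where
      interchange : ∀ a b c e → (a + b) + (c + e) ≡ (a + c) + (b + e)
      interchange = solve-∀

  B₂-⊛ʳ : ∀ x c y → B₂ x (c ⊛² y) ≡ c * B₂ x y
  B₂-⊛ʳ (g , h) c (k , l) =
    trans (cong₂ _+_ (·-⊛ʳ c g l) (·-⊛ˡ c k h)) (sym (ℤ.*-distribˡ-+ c (g · l) (k · h)))

  B₂-⊛ˡ : ∀ c x y → B₂ (c ⊛² x) y ≡ c * B₂ x y
  B₂-⊛ˡ c x y = begin
    B₂ (c ⊛² x) y  ≡⟨ B₂-comm (c ⊛² x) y ⟩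
    B₂ y (c ⊛² x)  ≡⟨ B₂-⊛ʳ y c x ⟩
    c * B₂ y x     ≡⟨ cong (c *_) (B₂-comm y x) ⟩
    c * B₂ x y     ∎

  B₂-⊝ʳ : ∀ x y → B₂ x (⊝² y) ≡ - B₂ x y
  B₂-⊝ʳ (g , h) (k , l) =
    trans (cong₂ _+_ (·-⊝ʳ g l) (·-⊝ˡ k h)) (sym (ℤ.neg-distrib-+ (g · l) (k · h)))

  B₂-0²ʳ : ∀ x → B₂ x 0² ≡ + 0
  B₂-0²ʳ (g , h) = cong₂ _+_ (·-zeroʳ g) (·-zeroˡ h)

  B₂-polar : ∀ x y → B₂ x y ≡ U₂ x + U₂ y - U₂ (x ⊖² y)
  B₂-polar x y = begin
    B₂ x y                                  ≡⟨ cancel (U₂ x + U₂ y) (B₂ x y) ⟩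
    U₂ x + U₂ y - (U₂ x + U₂ y + - B₂ x y)  ≡⟨ cong (λ t → U₂ x + U₂ y - t) U₂-⊖ ⟨
    U₂ x + U₂ y - U₂ (x ⊖² y)               ∎
    where
      cancel : ∀ s b → b ≡ s - (s + - b)
      cancel = solve-∀
      U₂-⊖ : U₂ (x ⊖² y) ≡ U₂ x + U₂ y + - B₂ x y
      U₂-⊖ = trans (U₂-⊕ x (⊝² y)) (cong₂ (λ s t → U₂ x + s + t) (U₂-⊝ y) (B₂-⊝ʳ x y))

  ⊖-cancelʳ : ∀ x y z → ((x ⊖ z) ⊖ (y ⊖ z)) ≗ (x ⊖ y)
  ⊖-cancelʳ x y z i = cancel (x i) (y i) (z i)
    where
      cancel : ∀ a b c → (a - c) - (b - c) ≡ a - b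
      cancel = solve-∀

  U₂-⊖-cancelʳ : ∀ a b c → U₂ ((a ⊖² c) ⊖² (b ⊖² c)) ≡ U₂ (a ⊖² b)
  U₂-⊖-cancelʳ (ga , ha) (gb , hb) (gc , hc) = ·-cong (⊖-cancelʳ ga gb gc) (⊖-cancelʳ ha hb hc)

  p^ds : Fin r → ℤ
  p^ds i = + (p ^ ds i)

  -- Elements are passed explicitly: x ≈ y unfolds to divisibilities of x i - y i,
  -- from which Agda cannot recover x and y.
  ≈⇒∣ : ∀ x y → x ≈ y → ∀ i → p^ds i ∣ x i - y i
  ≈⇒∣ x y x≈y i = ∣ᵤ⇒∣ (x≈y i)

  ∣⇒≈ : ∀ x y → (∀ i → p^ds i ∣ x i - y i) → x ≈ y
  ∣⇒≈ x y p^ds∣x-y i = ∣⇒∣ᵤ (p^ds∣x-y i)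

  ≗⇒≈ : ∀ x y → x ≗ y → x ≈ y
  ≗⇒≈ x y x≗y = ∣⇒≈ x y (λ i → subst (p^ds i ∣_) (sym (x-y≡0 i)) ∣+0)
    where
      x-y≡0 : ∀ i → x i - y i ≡ + 0
      x-y≡0 i = trans (cong (_- y i) (x≗y i)) (ℤ.+-inverseʳ (y i))

  ≈-sym : ∀ x y → x ≈ y → y ≈ x
  ≈-sym x y x≈y = ∣⇒≈ y x (λ i →
    subst (p^ds i ∣_) (negate (x i) (y i)) (∣m⇒∣-m (≈⇒∣ x y x≈y i)))
    where
      negate : ∀ a b → - (a - b) ≡ b - a
      negate = solve-∀

  ≈-trans : ∀ x y z → x ≈ y → y ≈ z → x ≈ z
  ≈-trans x y z x≈y y≈z = ∣⇒≈ x z (λ i →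
    subst (p^ds i ∣_) (telescope (x i) (y i) (z i)) (∣m∣n⇒∣m+n (≈⇒∣ x y x≈y i) (≈⇒∣ y z y≈z i)))
    where
      telescope : ∀ a b c → (a - b) + (b - c) ≡ a - c
      telescope = solve-∀

  ⊕-cong : ∀ x x' y y' → x ≈ x' → y ≈ y' → (x ⊕ y) ≈ (x' ⊕ y')
  ⊕-cong x x' y y' x≈x' y≈y' = ∣⇒≈ (x ⊕ y) (x' ⊕ y') (λ i →
    subst (p^ds i ∣_) (regroup (x i) (x' i) (y i) (y' i))
          (∣m∣n⇒∣m+n (≈⇒∣ x x' x≈x' i) (≈⇒∣ y y' y≈y' i)))
    where
      regroup : ∀ a a' b b' → (a - a') + (b - b') ≡ (a + b) - (a' + b')
      regroup = solve-∀

  ⊝-cong : ∀ x x' → x ≈ x' → (⊝ x) ≈ (⊝ x')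
  ⊝-cong x x' x≈x' = ∣⇒≈ (⊝ x) (⊝ x') (λ i →
    subst (p^ds i ∣_) (negate (x i) (x' i)) (∣m⇒∣-m (≈⇒∣ x x' x≈x' i)))
    where
      negate : ∀ a a' → - (a - a') ≡ (- a) - (- a')
      negate = solve-∀

  _≗²_ : Pair → Pair → Set
  a ≗² b = (proj₁ a ≗ proj₁ b) × (proj₂ a ≗ proj₂ b)

  ≗²⇒≈² : ∀ a b → a ≗² b → a ≈² b
  ≗²⇒≈² (g , h) (g' , h') (g≗g' , h≗h') = ≗⇒≈ g g' g≗g' , ≗⇒≈ h h' h≗h'

  ≈²-sym : ∀ a b → a ≈² b → b ≈² a
  ≈²-sym (g , h) (g' , h') (g≈g' , h≈h') = ≈-sym g g' g≈g' , ≈-sym h h' h≈h'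

  ≈²-trans : ∀ a b c → a ≈² b → b ≈² c → a ≈² c
  ≈²-trans (g , h) (g' , h') (g'' , h'') (g≈g' , h≈h') (g'≈g'' , h'≈h'') =
    ≈-trans g g' g'' g≈g' g'≈g'' , ≈-trans h h' h'' h≈h' h'≈h''

  ⊕²-cong : ∀ a a' b b' → a ≈² a' → b ≈² b' → (a ⊕² b) ≈² (a' ⊕² b')
  ⊕²-cong (g , h) (g' , h') (k , l) (k' , l') (g≈g' , h≈h') (k≈k' , l≈l') =
    ⊕-cong g g' k k' g≈g' k≈k' , ⊕-cong h h' l l' h≈h' l≈l'

  ⊝²-cong : ∀ a a' → a ≈² a' → (⊝² a) ≈² (⊝² a')
  ⊝²-cong (g , h) (g' , h') (g≈g' , h≈h') = ⊝-cong g g' g≈g' , ⊝-cong h h' h≈h'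

  0²-lin : ∀ {m} (v : Fin m → Pair) → 0² ≗² lin (λ _ → + 0) v
  0²-lin {zero}  v = (λ _ → refl) , (λ _ → refl)
  0²-lin {suc m} v = (λ i → step (proj₁ IH i)) , (λ i → step (proj₂ IH i))
    where
      IH = 0²-lin (v ∘ suc)
      step : ∀ {X} → + 0 ≡ X → + 0 ≡ + 0 + X
      step 0≡X = trans 0≡X (sym (ℤ.+-identityˡ _))

  ⊕²-lin : ∀ {m} (c c' : Fin m → ℤ) (v : Fin m → Pair) →
           (lin c v ⊕² lin c' v) ≗² lin (λ k → c k + c' k) v
  ⊕²-lin {zero}  c c' v = (λ _ → refl) , (λ _ → refl)
  ⊕²-lin {suc m} c c' v = (λ i → step (proj₁ IH i)) , (λ i → step (proj₂ IH i))
    where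
      IH = ⊕²-lin (c ∘ suc) (c' ∘ suc) (v ∘ suc)
      regroup : ∀ s t a x y → (s * a + x) + (t * a + y) ≡ (s + t) * a + (x + y)
      regroup = solve-∀
      step : ∀ {a X Y Z} → X + Y ≡ Z →
             (c zero * a + X) + (c' zero * a + Y) ≡ (c zero + c' zero) * a + Z
      step {a} {X} {Y} refl = regroup (c zero) (c' zero) a X Y

  ⊝²-lin : ∀ {m} (c : Fin m → ℤ) (v : Fin m → Pair) → (⊝² lin c v) ≗² lin (λ k → - c k) v
  ⊝²-lin {zero}  c v = (λ _ → refl) , (λ _ → refl)
  ⊝²-lin {suc m} c v = (λ i → step (proj₁ IH i)) , (λ i → step (proj₂ IH i))
    where
      IH = ⊝²-lin (c ∘ suc) (v ∘ suc)
      negate : ∀ s a x → - (s * a + x) ≡ (- s) * a + - x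
      negate = solve-∀
      step : ∀ {a X Z} → - X ≡ Z → - (c zero * a + X) ≡ (- c zero) * a + Z
      step {a} {X} refl = negate (c zero) a X

  δ : ∀ {m} → Fin m → Fin m → ℤ
  δ zero    zero    = + 1
  δ zero    (suc _) = + 0
  δ (suc _) zero    = + 0
  δ (suc k) (suc l) = δ k l

  lin-δ : ∀ {m} k (v : Fin m → Pair) → v k ≗² lin (δ k) v
  lin-δ zero    v = (λ i → step (proj₁ IH i)) , (λ i → step (proj₂ IH i))
    where
      IH = 0²-lin (v ∘ suc)
      step : ∀ {a X} → + 0 ≡ X → a ≡ + 1 * a + X
      step {a} refl = sym (trans (ℤ.+-identityʳ _) (ℤ.*-identityˡ a))
  lin-δ (suc k) v = (λ i → step (proj₁ IH i)) , (λ i → step (proj₂ IH i))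
    where
      IH = lin-δ k (v ∘ suc)
      step : ∀ {a X} → a ≡ X → a ≡ + 0 + X
      step a≡X = trans a≡X (sym (ℤ.+-identityˡ _))

  generator∈Span : ∀ {m} (v : Fin m → Pair) k → Span v (v k)
  generator∈Span v k = δ k , ≗²⇒≈² (v k) (lin (δ k) v) (lin-δ k v)

  Span-isSubgroup : ∀ {m} (v : Fin m → Pair) → IsSubgroup (Span v)
  Span-isSubgroup v = record
    { resp  = λ {a} {b} a≈b (c , a≈lin) → c , ≈²-trans b a (lin c v) (≈²-sym a b a≈b) a≈lin
    ; zero∈ = (λ _ → + 0) , ≗²⇒≈² 0² _ (0²-lin v)
    ; add∈  = λ {a} {b} (c , a≈lin) (c' , b≈lin) → (λ k → c k + c' k) ,
        ≈²-trans (a ⊕² b) (lin c v ⊕² lin c' v) _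
          (⊕²-cong a (lin c v) b (lin c' v) a≈lin b≈lin) (≗²⇒≈² _ _ (⊕²-lin c c' v))
    ; neg∈  = λ {a} (c , a≈lin) → (λ k → - c k) ,
        ≈²-trans (⊝² a) (⊝² lin c v) _ (⊝²-cong a (lin c v) a≈lin) (≗²⇒≈² _ _ (⊝²-lin c v))
    }

  ⊖-fromℕ∈ : ∀ {W m} (gs : Fin (suc m) → Pair) → IsSubgroup W →
             (∀ k → W (gs (inject₁ k) ⊖² gs (fromℕ m))) → ∀ k → W (gs k ⊖² gs (fromℕ m))
  ⊖-fromℕ∈ {m = m} gs W-subgroup inject₁∈W k with view k
  ... | ‵fromℕ     = resp (≗²⇒≈² 0² (a ⊖² a) (0≡a-a ∘ proj₁ a , 0≡a-a ∘ proj₂ a)) zero∈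
    where
      open IsSubgroup W-subgroup
      a = gs (fromℕ m)
      0≡a-a : ∀ z → + 0 ≡ z - z
      0≡a-a z = sym (ℤ.+-inverseʳ z)
  ... | ‵inject₁ j = inject₁∈W j

  pᵈ∣U₂-⊖ : ∀ a b → pᵈ ∣ B a b → pᵈ ∣ U₂ (a ⊖² b)
  pᵈ∣U₂-⊖ a b pᵈ∣B = subst (pᵈ ∣_) (ℤ.neg-involutive _) (∣m⇒∣-m pᵈ∣B)

  pᵈ∣B₂-⊖ : ∀ a b c → pᵈ ∣ B a c → pᵈ ∣ B b c → pᵈ ∣ B a b → pᵈ ∣ B₂ (a ⊖² c) (b ⊖² c)
  pᵈ∣B₂-⊖ a b c pᵈ∣Bac pᵈ∣Bbc pᵈ∣Bab = subst (pᵈ ∣_) (sym (B₂-polar (a ⊖² c) (b ⊖² c)))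
    (∣m∣n⇒∣m-n (∣m∣n⇒∣m+n (pᵈ∣U₂-⊖ a c pᵈ∣Bac) (pᵈ∣U₂-⊖ b c pᵈ∣Bbc))
               (subst (pᵈ ∣_) (sym (U₂-⊖-cancelʳ a b c)) (pᵈ∣U₂-⊖ a b pᵈ∣Bab)))

  InIso⇒IsZeroR-B : ∀ {W} → InIso W → ∀ a b c → W (a ⊖² c) → W (b ⊖² c) → IsZeroR (B a b)
  InIso⇒IsZeroR-B iso a b c a-c∈W b-c∈W =
    ∣⇒∣ᵤ (∣m⇒∣-m (subst (pᵈ ∣_) (U₂-⊖-cancelʳ a b c) (∣ᵤ⇒∣ (U₂-zero _ (add∈ a-c∈W (neg∈ b-c∈W))))))
    where
      open InIso iso
      open IsSubgroup subgroup

  pᵈ∣B₂-lin : ∀ {m} (v : Fin m → Pair) y → (∀ k → pᵈ ∣ B₂ y (v k)) → ∀ c → pᵈ ∣ B₂ y (lin c v)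
  pᵈ∣B₂-lin {zero}  v y _        c = subst (pᵈ ∣_) (sym (B₂-0²ʳ y)) ∣+0
  pᵈ∣B₂-lin {suc m} v y pᵈ∣B₂y-v c = subst (pᵈ ∣_) (sym expand)
    (∣m∣n⇒∣m+n (∣n⇒∣m*n (c zero) (pᵈ∣B₂y-v zero))
               (pᵈ∣B₂-lin (v ∘ suc) y (pᵈ∣B₂y-v ∘ suc) (c ∘ suc)))
    where
      L = lin (c ∘ suc) (v ∘ suc)
      expand : B₂ y ((c zero ⊛² v zero) ⊕² L) ≡ c zero * B₂ y (v zero) + B₂ y L
      expand = trans (B₂-⊕ʳ y (c zero ⊛² v zero) L) (cong (_+ B₂ y L) (B₂-⊛ʳ y (c zero) (v zero)))

  pᵈ∣B₂-lin-lin : ∀ {m} (v : Fin m → Pair) → (∀ k l → pᵈ ∣ B₂ (v k) (v l)) →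
                  ∀ c c' → pᵈ ∣ B₂ (lin c v) (lin c' v)
  pᵈ∣B₂-lin-lin v pᵈ∣B₂v c = pᵈ∣B₂-lin v (lin c v) (λ l →
    subst (pᵈ ∣_) (B₂-comm (v l) (lin c v)) (pᵈ∣B₂-lin v (v l) (pᵈ∣B₂v l) c))

  pᵈ∣U₂-lin : ∀ {m} (v : Fin m → Pair) → (∀ k → pᵈ ∣ U₂ (v k)) → (∀ k l → pᵈ ∣ B₂ (v k) (v l)) →
              ∀ c → pᵈ ∣ U₂ (lin c v)
  pᵈ∣U₂-lin {zero}  v _       _       c = subst (pᵈ ∣_) (sym U₂-0²) ∣+0
  pᵈ∣U₂-lin {suc m} v pᵈ∣U₂v pᵈ∣B₂v c = subst (pᵈ ∣_) (sym expand)
    (∣m∣n⇒∣m+n (∣m∣n⇒∣m+n (∣n⇒∣m*n c₀ (∣n⇒∣m*n c₀ (pᵈ∣U₂v zero)))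
                          (pᵈ∣U₂-lin (v ∘ suc) (pᵈ∣U₂v ∘ suc) (λ k l → pᵈ∣B₂v (suc k) (suc l))
                                     (c ∘ suc)))
               (∣n⇒∣m*n c₀ (pᵈ∣B₂-lin (v ∘ suc) (v zero) (pᵈ∣B₂v zero ∘ suc) (c ∘ suc))))
    where
      c₀ = c zero
      L = lin (c ∘ suc) (v ∘ suc)
      expand : U₂ ((c₀ ⊛² v zero) ⊕² L) ≡ c₀ * (c₀ * U₂ (v zero)) + U₂ L + c₀ * B₂ (v zero) L
      expand = trans (U₂-⊕ (c₀ ⊛² v zero) L)
                     (cong₂ (λ s t → s + U₂ L + t) (U₂-⊛ c₀ (v zero)) (B₂-⊛ˡ c₀ (v zero) L))

  module _ (ds≤d : ∀ i → ds i ≤ d) where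

    weight*p^ds≡pᵈ : ∀ i → weight i * p^ds i ≡ pᵈ
    weight*p^ds≡pᵈ i = trans (sym (ℤ.pos-* (p ^ (d ∸ ds i)) (p ^ ds i)))
      (cong +_ (trans (sym (ℕ.^-distribˡ-+-* p (d ∸ ds i) (ds i)))
                      (cong (p ^_) (ℕ.m∸n+n≡m (ds≤d i)))))

    ≈⇒pᵈ∣⊖· : ∀ x y z → x ≈ y → pᵈ ∣ (x ⊖ y) · z
    ≈⇒pᵈ∣⊖· x y z x≈y = ∣-sumFin _ (λ i → subst (_∣ weight i * ((x ⊖ y) i * z i)) (weight*p^ds≡pᵈ i)
      (*-monoʳ-∣ (weight i) (∣m⇒∣m*n (z i) (≈⇒∣ x y x≈y i))))

    ·-resp-≈ : ∀ x x' y y' → x ≈ x' → y ≈ y' → pᵈ ∣ x · y - x' · y'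
    ·-resp-≈ x x' y y' x≈x' y≈y' = subst (pᵈ ∣_) split
      (∣m∣n⇒∣m+n (≈⇒pᵈ∣⊖· x x' y x≈x')
                 (subst (pᵈ ∣_) (·-comm (y ⊖ y') x') (≈⇒pᵈ∣⊖· y y' x' y≈y')))
      where
        telescope : ∀ a b c → (a - b) + (b - c) ≡ a - c
        telescope = solve-∀
        split : (x ⊖ x') · y + x' · (y ⊖ y') ≡ x · y - x' · y'
        split = trans (cong₂ _+_ (·-⊖ˡ x x' y) (·-⊖ʳ x' y y'))
                      (telescope (x · y) (x' · y) (x' · y'))

    U₂-resp-≈ : ∀ a b → a ≈² b → pᵈ ∣ U₂ a - U₂ b
    U₂-resp-≈ (g , h) (g' , h') (g≈g' , h≈h') = ·-resp-≈ g g' h h' g≈g' h≈h'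

    B₂-resp-≈ : ∀ a a' b b' → a ≈² a' → b ≈² b' → pᵈ ∣ B₂ a b - B₂ a' b'
    B₂-resp-≈ (g , h) (g' , h') (k , l) (k' , l') (g≈g' , h≈h') (k≈k' , l≈l') = subst (pᵈ ∣_)
      (regroup (g · l) (g' · l') (k · h) (k' · h'))
      (∣m∣n⇒∣m+n (·-resp-≈ g g' l l' g≈g' l≈l') (·-resp-≈ k k' h h' k≈k' h≈h'))
      where
        regroup : ∀ a a' b b' → (a - a') + (b - b') ≡ (a + b) - (a' + b')
        regroup = solve-∀

    Span-InIso : ∀ {m} (v : Fin m → Pair) → (∀ k → pᵈ ∣ U₂ (v k)) → (∀ k l → pᵈ ∣ B₂ (v k) (v l)) →
                 InIso (Span v)
    Span-InIso v pᵈ∣U₂v pᵈ∣B₂v = record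
      { subgroup = Span-isSubgroup v
      ; U₂-zero  = λ w (c , w≈lin) →
          ∣⇒∣ᵤ {i = U₂ w} (∣m-n∣n⇒∣m (U₂-resp-≈ w (lin c v) w≈lin) (pᵈ∣U₂-lin v pᵈ∣U₂v pᵈ∣B₂v c))
      ; B₂-zero  = λ w w' (c , w≈lin) (c' , w'≈lin) →
          ∣⇒∣ᵤ {i = B₂ w w'} (∣m-n∣n⇒∣m (B₂-resp-≈ w (lin c v) w' (lin c' v) w≈lin w'≈lin)
                                         (pᵈ∣B₂-lin-lin v pᵈ∣B₂v c c'))
      }

lemma3p2 : (p d r : ℕ) (ds : Fin r → ℕ) → Prime p
  → (∀ i → ds i ≤ d) → (∀ i → 1 ≤ ds i) → (∀ i j → i F.≤ j → ds j ≤ ds i)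
  → (m : ℕ) (gs : Fin (suc m) → G.Pair p d r ds)
  → (∀ k l → G.IsZeroR p d r ds (G.B p d r ds (gs k) (gs l)))
    ⇔ Σ (G.Pair p d r ds → Set) (λ W → G.InIso p d r ds W
        × (∀ x → W x ⇔ G.Span p d r ds (λ k → G._⊖²_ p d r ds (gs (inject₁ k)) (gs (fromℕ m))) x))
lemma3p2 p d r ds _ ds≤d _ _ m gs = mk⇔ span-of-differences B-vanishes
  where
    open G p d r ds
    open Properties p d r ds

    v : Fin m → Pair
    v k = gs (inject₁ k) ⊖² gs (fromℕ m)

    span-of-differences : (∀ k l → IsZeroR (B (gs k) (gs l))) →
                          Σ (Pair → Set) (λ W → InIso W × (∀ x → W x ⇔ Span v x))
    span-of-differences B≡0 = Span v , Span-InIso ds≤d v pᵈ∣U₂v pᵈ∣B₂v , λ _ → ⇔.refl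
      where
        pᵈ∣B : ∀ k l → pᵈ ∣ B (gs k) (gs l)
        pᵈ∣B k l = ∣ᵤ⇒∣ (B≡0 k l)
        pᵈ∣U₂v : ∀ k → pᵈ ∣ U₂ (v k)
        pᵈ∣U₂v k = pᵈ∣U₂-⊖ (gs (inject₁ k)) (gs (fromℕ m)) (pᵈ∣B _ _)
        pᵈ∣B₂v : ∀ k l → pᵈ ∣ B₂ (v k) (v l)
        pᵈ∣B₂v k l = pᵈ∣B₂-⊖ (gs (inject₁ k)) (gs (inject₁ l)) (gs (fromℕ m))
                             (pᵈ∣B _ _) (pᵈ∣B _ _) (pᵈ∣B _ _)

    B-vanishes : Σ (Pair → Set) (λ W → InIso W × (∀ x → W x ⇔ Span v x)) →
                 ∀ k l → IsZeroR (B (gs k) (gs l))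
    B-vanishes (W , W-iso , W⇔Span) k l =
      InIso⇒IsZeroR-B W-iso (gs k) (gs l) (gs (fromℕ m)) (⊖∈W k) (⊖∈W l)
      where
        ⊖∈W : ∀ k → W (gs k ⊖² gs (fromℕ m))
        ⊖∈W = ⊖-fromℕ∈ gs (InIso.subgroup W-iso)
                       (λ k → Equivalence.from (W⇔Span (v k)) (generator∈Span v k))
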